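{- If $\Gamma\Rightarrow A$ has a derivation in $\mathsf{L_{RBL}}$, then it has a derivation in which all formulae are $\top$, $\bot$, or subformulae of formulae in $\Gamma$ or of $A$.
   Context: $\mathcal{L}_{\mathrm{RBL}}$-formulae are built from propositional letters by $\bot,\top,\wedge,\vee,\cdot,\rightarrow,\leftarrow$. Formula structures: formulae, and $\Gamma\odot\Delta$, $\Gamma\mathbin{\bar{\wedge}}\Delta$ for structures $\Gamma,\Delta$ ($\odot$ is the structural counterpart of $\cdot$, $\mathbin{\bar{\wedge}}$ of $\wedge$). $\mathsf{L_{RBL}}$ is the sequent calculus for $\Gamma\Rightarrow A$ with axioms $A\Rightarrow A$, $A\Rightarrow\top$, $\bot\Rightarrow A$; left/right introduction rules for $\rightarrow,\leftarrow,\cdot,\wedge,\vee$ (with $\odot$ for $\cdot,\rightarrow,\leftarrow$ and $\mathbin{\bar{\wedge}}$ for $\wedge$; $(\rightarrow R),(\leftarrow R)$ only for nonempty antecedents); contraction, exchange and associativity for $\mathbin{\bar{\wedge}}$; restricted contraction from $\Gamma[(\Lambda\odot\Delta)\odot\Delta]\Rightarrow A$ to $\Gamma[\Lambda\odot\Delta]\Rightarrow A$ ($\Lambda$ nonempty); weakening on either side for both $\odot$ and $\mathbin{\bar{\wedge}}$; and Cut. It follows from mix elimination: every derivable sequent has a derivation using Cut/Mix only on $\bot$ or $\top$. -}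

module Defs where

open import Data.Nat using (ℕ)
open import Data.Unit using (⊤; tt)
open import Data.Sum using (_⊎_)
open import Data.Product using (Σ; _×_; ∃-syntax)
open import Relation.Binary.PropositionalEquality using (_≡_)

infixr 6 _⊸_
infixl 6 _⟜_
infixl 7 _·_
infixl 8 _∧_ _∨_

data Fm : Set where
  var  : ℕ → Fm
  `⊥ `⊤ : Fm
  _∧_ _∨_ _·_ : Fm → Fm → Fm
  _⊸_ : Fm → Fm → Fm   -- A → B  (right residual: A · (A → B) ⊢ B)
  _⟜_ : Fm → Fm → Fm   -- B ← A  (left residual:  (B ← A) · A ⊢ B)

infixl 5 _⊙_ _∧̄_
data Str : Set where
  fm  : Fm → Str
  _⊙_ : Str → Str → Str
  _∧̄_ : Str → Str → Str

data Ctx : Set where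
  []   : Ctx
  _⊙ₗ_ : Ctx → Str → Ctx
  _⊙ᵣ_ : Str → Ctx → Ctx
  _∧̄ₗ_ : Ctx → Str → Ctx
  _∧̄ᵣ_ : Str → Ctx → Ctx

_[_] : Ctx → Str → Str
[] [ Δ ] = Δ
(Γ ⊙ₗ Λ) [ Δ ] = (Γ [ Δ ]) ⊙ Λ
(Λ ⊙ᵣ Γ) [ Δ ] = Λ ⊙ (Γ [ Δ ])
(Γ ∧̄ₗ Λ) [ Δ ] = (Γ [ Δ ]) ∧̄ Λ
(Λ ∧̄ᵣ Γ) [ Δ ] = Λ ∧̄ (Γ [ Δ ])

infix 4 _⊑_ _∈ˢ_
data _⊑_ : Fm → Fm → Set where
  ⊑-refl : ∀ {A} → A ⊑ A
  ⊑∧ₗ : ∀ {A B C} → A ⊑ B → A ⊑ B ∧ C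
  ⊑∧ᵣ : ∀ {A B C} → A ⊑ C → A ⊑ B ∧ C
  ⊑∨ₗ : ∀ {A B C} → A ⊑ B → A ⊑ B ∨ C
  ⊑∨ᵣ : ∀ {A B C} → A ⊑ C → A ⊑ B ∨ C
  ⊑·ₗ : ∀ {A B C} → A ⊑ B → A ⊑ B · C
  ⊑·ᵣ : ∀ {A B C} → A ⊑ C → A ⊑ B · C
  ⊑⊸ₗ : ∀ {A B C} → A ⊑ B → A ⊑ B ⊸ C
  ⊑⊸ᵣ : ∀ {A B C} → A ⊑ C → A ⊑ B ⊸ C
  ⊑⟜ₗ : ∀ {A B C} → A ⊑ B → A ⊑ B ⟜ C
  ⊑⟜ᵣ : ∀ {A B C} → A ⊑ C → A ⊑ B ⟜ C

data _∈ˢ_ : Fm → Str → Set where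
  here : ∀ {A} → A ∈ˢ fm A
  ⊙ₗ : ∀ {A Γ Δ} → A ∈ˢ Γ → A ∈ˢ (Γ ⊙ Δ)
  ⊙ᵣ : ∀ {A Γ Δ} → A ∈ˢ Δ → A ∈ˢ (Γ ⊙ Δ)
  ∧̄ₗ : ∀ {A Γ Δ} → A ∈ˢ Γ → A ∈ˢ (Γ ∧̄ Δ)
  ∧̄ᵣ : ∀ {A Γ Δ} → A ∈ˢ Δ → A ∈ˢ (Γ ∧̄ Δ)

SeqOK : (Fm → Set) → Str → Fm → Set
SeqOK P Γ A = (∀ {B} → B ∈ˢ Γ → P B) × P A

-- The calculus L_RBL, with each rule guarded by the requirement that
-- every formula in its conclusion satisfies P.  Since every sequent of a
-- derivation is the conclusion of some rule instance, a derivation in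
-- L⟨ P ⟩ is exactly an L_RBL derivation all of whose formulae satisfy P.
infix 3 L⟨_⟩_⇒_
data L⟨_⟩_⇒_ (P : Fm → Set) : Str → Fm → Set where
  ax   : ∀ {A} → SeqOK P (fm A) A → L⟨ P ⟩ fm A ⇒ A
  ax⊤  : ∀ {A} → SeqOK P (fm A) `⊤ → L⟨ P ⟩ fm A ⇒ `⊤
  ax⊥  : ∀ {A} → SeqOK P (fm `⊥) A → L⟨ P ⟩ fm `⊥ ⇒ A
  ⊸L : ∀ {Γ Δ A B C} → SeqOK P (Γ [ Δ ⊙ fm (A ⊸ B) ]) C →
       L⟨ P ⟩ Δ ⇒ A → L⟨ P ⟩ Γ [ fm B ] ⇒ C → L⟨ P ⟩ Γ [ Δ ⊙ fm (A ⊸ B) ] ⇒ C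
  ⊸R : ∀ {Γ A B} → SeqOK P Γ (A ⊸ B) →
       L⟨ P ⟩ fm A ⊙ Γ ⇒ B → L⟨ P ⟩ Γ ⇒ A ⊸ B
  ⟜L : ∀ {Γ Δ A B C} → SeqOK P (Γ [ fm (B ⟜ A) ⊙ Δ ]) C →
       L⟨ P ⟩ Δ ⇒ A → L⟨ P ⟩ Γ [ fm B ] ⇒ C → L⟨ P ⟩ Γ [ fm (B ⟜ A) ⊙ Δ ] ⇒ C
  ⟜R : ∀ {Γ A B} → SeqOK P Γ (B ⟜ A) →
       L⟨ P ⟩ Γ ⊙ fm A ⇒ B → L⟨ P ⟩ Γ ⇒ B ⟜ A
  ·L : ∀ {Γ A B C} → SeqOK P (Γ [ fm (A · B) ]) C →
       L⟨ P ⟩ Γ [ fm A ⊙ fm B ] ⇒ C → L⟨ P ⟩ Γ [ fm (A · B) ] ⇒ C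
  ·R : ∀ {Γ Δ A B} → SeqOK P (Γ ⊙ Δ) (A · B) →
       L⟨ P ⟩ Γ ⇒ A → L⟨ P ⟩ Δ ⇒ B → L⟨ P ⟩ Γ ⊙ Δ ⇒ A · B
  ∧L : ∀ {Γ A B C} → SeqOK P (Γ [ fm (A ∧ B) ]) C →
       L⟨ P ⟩ Γ [ fm A ∧̄ fm B ] ⇒ C → L⟨ P ⟩ Γ [ fm (A ∧ B) ] ⇒ C
  ∧R : ∀ {Γ Δ A B} → SeqOK P (Γ ∧̄ Δ) (A ∧ B) →
       L⟨ P ⟩ Γ ⇒ A → L⟨ P ⟩ Δ ⇒ B → L⟨ P ⟩ Γ ∧̄ Δ ⇒ A ∧ B
  ∨L : ∀ {Γ A B C} → SeqOK P (Γ [ fm (A ∨ B) ]) C →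
       L⟨ P ⟩ Γ [ fm A ] ⇒ C → L⟨ P ⟩ Γ [ fm B ] ⇒ C → L⟨ P ⟩ Γ [ fm (A ∨ B) ] ⇒ C
  ∨R₁ : ∀ {Γ A B} → SeqOK P Γ (A ∨ B) → L⟨ P ⟩ Γ ⇒ A → L⟨ P ⟩ Γ ⇒ A ∨ B
  ∨R₂ : ∀ {Γ A B} → SeqOK P Γ (A ∨ B) → L⟨ P ⟩ Γ ⇒ B → L⟨ P ⟩ Γ ⇒ A ∨ B
  con∧̄ : ∀ {Γ Δ C} → SeqOK P (Γ [ Δ ]) C →
       L⟨ P ⟩ Γ [ Δ ∧̄ Δ ] ⇒ C → L⟨ P ⟩ Γ [ Δ ] ⇒ C
  exch∧̄ : ∀ {Γ Δ Λ C} → SeqOK P (Γ [ Λ ∧̄ Δ ]) C →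
       L⟨ P ⟩ Γ [ Δ ∧̄ Λ ] ⇒ C → L⟨ P ⟩ Γ [ Λ ∧̄ Δ ] ⇒ C
  assoc∧̄₁ : ∀ {Γ Δ₁ Δ₂ Δ₃ C} → SeqOK P (Γ [ Δ₁ ∧̄ (Δ₂ ∧̄ Δ₃) ]) C →
       L⟨ P ⟩ Γ [ (Δ₁ ∧̄ Δ₂) ∧̄ Δ₃ ] ⇒ C → L⟨ P ⟩ Γ [ Δ₁ ∧̄ (Δ₂ ∧̄ Δ₃) ] ⇒ C
  assoc∧̄₂ : ∀ {Γ Δ₁ Δ₂ Δ₃ C} → SeqOK P (Γ [ (Δ₁ ∧̄ Δ₂) ∧̄ Δ₃ ]) C →
       L⟨ P ⟩ Γ [ Δ₁ ∧̄ (Δ₂ ∧̄ Δ₃) ] ⇒ C → L⟨ P ⟩ Γ [ (Δ₁ ∧̄ Δ₂) ∧̄ Δ₃ ] ⇒ C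
  con⊙ : ∀ {Γ Λ Δ C} → SeqOK P (Γ [ Λ ⊙ Δ ]) C →
       L⟨ P ⟩ Γ [ (Λ ⊙ Δ) ⊙ Δ ] ⇒ C → L⟨ P ⟩ Γ [ Λ ⊙ Δ ] ⇒ C
  wk⊙ₗ : ∀ {Γ Δ Λ C} → SeqOK P (Γ [ Λ ⊙ Δ ]) C →
       L⟨ P ⟩ Γ [ Δ ] ⇒ C → L⟨ P ⟩ Γ [ Λ ⊙ Δ ] ⇒ C
  wk⊙ᵣ : ∀ {Γ Δ Λ C} → SeqOK P (Γ [ Δ ⊙ Λ ]) C →
       L⟨ P ⟩ Γ [ Δ ] ⇒ C → L⟨ P ⟩ Γ [ Δ ⊙ Λ ] ⇒ C
  wk∧̄ₗ : ∀ {Γ Δ Λ C} → SeqOK P (Γ [ Λ ∧̄ Δ ]) C →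
       L⟨ P ⟩ Γ [ Δ ] ⇒ C → L⟨ P ⟩ Γ [ Λ ∧̄ Δ ] ⇒ C
  wk∧̄ᵣ : ∀ {Γ Δ Λ C} → SeqOK P (Γ [ Δ ∧̄ Λ ]) C →
       L⟨ P ⟩ Γ [ Δ ] ⇒ C → L⟨ P ⟩ Γ [ Δ ∧̄ Λ ] ⇒ C
  cut : ∀ {Γ Δ A C} → SeqOK P (Γ [ Δ ]) C →
       L⟨ P ⟩ Δ ⇒ A → L⟨ P ⟩ Γ [ fm A ] ⇒ C → L⟨ P ⟩ Γ [ Δ ] ⇒ C

Any : Fm → Set
Any _ = ⊤

_⊢_ : Str → Fm → Set
Γ ⊢ A = L⟨ Any ⟩ Γ ⇒ A

SubOf : Str → Fm → Fm → Set
SubOf Γ A B = (B ≡ `⊤) ⊎ (B ≡ `⊥) ⊎ (∃[ C ] (C ∈ˢ Γ × B ⊑ C)) ⊎ (B ⊑ A)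

-- An algebraic proof, via residuated frames.  Fix the predicate P of
-- "allowed" formulae and pair a structure Γ with a context-goal pair
-- (Ψ, C) when Ψ[Γ] ⇒ C has a derivation all of whose formulae satisfy P.
-- The Galois-closed sets of structures of this frame form a model of
-- L_RBL in which every rule, cut included, is sound.  Dually, for a
-- formula A all of whose subformulae satisfy P, the structure A lies in
-- ⟦ A ⟧ and every structure in ⟦ A ⟧ derives A inside P.  Taking for P
-- "⊤, ⊥, or a subformula of Γ ⇒ A", soundness carries Γ ∈ ⟦ Γ ⟧ into
-- ⟦ A ⟧, and hence to a P-restricted derivation of Γ ⇒ A.
module Submission where

open import Data.Empty using (⊥)
open import Data.Product using (_×_; _,_; proj₁; proj₂)
open import Data.Sum using (inj₁; inj₂; [_,_]′)
open import Data.Unit using (⊤; tt)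
open import Function using (_∘_)
open import Level using (0ℓ)
open import Relation.Binary.PropositionalEquality using (_≡_; refl; cong; subst; sym)
open import Relation.Unary using (Pred; _⊆_; _∩_; _∪_; ∅)

open import Defs

infixl 6 _∘ᶜ_

_∘ᶜ_ : Ctx → Ctx → Ctx
[] ∘ᶜ Φ = Φ
(Ψ ⊙ₗ Λ) ∘ᶜ Φ = _⊙ₗ_ (Ψ ∘ᶜ Φ) Λ
(Λ ⊙ᵣ Ψ) ∘ᶜ Φ = _⊙ᵣ_ Λ (Ψ ∘ᶜ Φ)
(Ψ ∧̄ₗ Λ) ∘ᶜ Φ = _∧̄ₗ_ (Ψ ∘ᶜ Φ) Λ
(Λ ∧̄ᵣ Ψ) ∘ᶜ Φ = _∧̄ᵣ_ Λ (Ψ ∘ᶜ Φ)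

plug-∘ᶜ : ∀ Ψ Φ Γ → (Ψ ∘ᶜ Φ) [ Γ ] ≡ Ψ [ Φ [ Γ ] ]
plug-∘ᶜ [] Φ Γ = refl
plug-∘ᶜ (Ψ ⊙ₗ Λ) Φ Γ = cong (_⊙ Λ) (plug-∘ᶜ Ψ Φ Γ)
plug-∘ᶜ (Λ ⊙ᵣ Ψ) Φ Γ = cong (Λ ⊙_) (plug-∘ᶜ Ψ Φ Γ)
plug-∘ᶜ (Ψ ∧̄ₗ Λ) Φ Γ = cong (_∧̄ Λ) (plug-∘ᶜ Ψ Φ Γ)
plug-∘ᶜ (Λ ∧̄ᵣ Ψ) Φ Γ = cong (Λ ∧̄_) (plug-∘ᶜ Ψ Φ Γ)

module Frame (P : Fm → Set) where

  Allˢ : Str → Set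
  Allˢ (fm A) = P A
  Allˢ (Γ ⊙ Δ) = Allˢ Γ × Allˢ Δ
  Allˢ (Γ ∧̄ Δ) = Allˢ Γ × Allˢ Δ

  Allᶜ : Ctx → Set
  Allᶜ [] = ⊤
  Allᶜ (Ψ ⊙ₗ Λ) = Allᶜ Ψ × Allˢ Λ
  Allᶜ (Λ ⊙ᵣ Ψ) = Allˢ Λ × Allᶜ Ψ
  Allᶜ (Ψ ∧̄ₗ Λ) = Allᶜ Ψ × Allˢ Λ
  Allᶜ (Λ ∧̄ᵣ Ψ) = Allˢ Λ × Allᶜ Ψ

  AllSub : Fm → Set
  AllSub A = ∀ {B} → B ⊑ A → P B

  Allˢ⇒∈ˢ : ∀ {Γ} → Allˢ Γ → ∀ {B} → B ∈ˢ Γ → P B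
  Allˢ⇒∈ˢ p here = p
  Allˢ⇒∈ˢ (p , _) (⊙ₗ m) = Allˢ⇒∈ˢ p m
  Allˢ⇒∈ˢ (_ , q) (⊙ᵣ m) = Allˢ⇒∈ˢ q m
  Allˢ⇒∈ˢ (p , _) (∧̄ₗ m) = Allˢ⇒∈ˢ p m
  Allˢ⇒∈ˢ (_ , q) (∧̄ᵣ m) = Allˢ⇒∈ˢ q m

  plug-Allˢ : ∀ Ψ {Γ} → Allᶜ Ψ → Allˢ Γ → Allˢ (Ψ [ Γ ])
  plug-Allˢ [] _ g = g
  plug-Allˢ (Ψ ⊙ₗ Λ) (p , l) g = plug-Allˢ Ψ p g , l
  plug-Allˢ (Λ ⊙ᵣ Ψ) (l , p) g = l , plug-Allˢ Ψ p g
  plug-Allˢ (Ψ ∧̄ₗ Λ) (p , l) g = plug-Allˢ Ψ p g , l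
  plug-Allˢ (Λ ∧̄ᵣ Ψ) (l , p) g = l , plug-Allˢ Ψ p g

  Allᶜ-∘ᶜ : ∀ Ψ Φ → Allᶜ Ψ → Allᶜ Φ → Allᶜ (Ψ ∘ᶜ Φ)
  Allᶜ-∘ᶜ [] Φ _ q = q
  Allᶜ-∘ᶜ (Ψ ⊙ₗ Λ) Φ (p , l) q = Allᶜ-∘ᶜ Ψ Φ p q , l
  Allᶜ-∘ᶜ (Λ ⊙ᵣ Ψ) Φ (l , p) q = l , Allᶜ-∘ᶜ Ψ Φ p q
  Allᶜ-∘ᶜ (Ψ ∧̄ₗ Λ) Φ (p , l) q = Allᶜ-∘ᶜ Ψ Φ p q , l
  Allᶜ-∘ᶜ (Λ ∧̄ᵣ Ψ) Φ (l , p) q = l , Allᶜ-∘ᶜ Ψ Φ p q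

  seqOK : ∀ {Γ C} → Allˢ Γ → P C → SeqOK P Γ C
  seqOK g c = Allˢ⇒∈ˢ g , c

  seqOKᶜ : ∀ Ψ {Γ C} → Allᶜ Ψ → Allˢ Γ → P C → SeqOK P (Ψ [ Γ ]) C
  seqOKᶜ Ψ p g = seqOK (plug-Allˢ Ψ p g)

  Derivable : Fm → Pred Str 0ℓ
  Derivable C Γ = L⟨ P ⟩ Γ ⇒ C

  weaken-into : ∀ Ψ {Δ C} → Allᶜ Ψ → Allˢ Δ → P C →
                L⟨ P ⟩ Δ ⇒ C → L⟨ P ⟩ Ψ [ Δ ] ⇒ C
  weaken-into [] _ _ _ d = d
  weaken-into (Ψ ⊙ₗ Λ) (p , l) δ c d =
    wk⊙ᵣ {Γ = []} (seqOK (plug-Allˢ Ψ p δ , l) c) (weaken-into Ψ p δ c d)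
  weaken-into (Λ ⊙ᵣ Ψ) (l , p) δ c d =
    wk⊙ₗ {Γ = []} (seqOK (l , plug-Allˢ Ψ p δ) c) (weaken-into Ψ p δ c d)
  weaken-into (Ψ ∧̄ₗ Λ) (p , l) δ c d =
    wk∧̄ᵣ {Γ = []} (seqOK (plug-Allˢ Ψ p δ , l) c) (weaken-into Ψ p δ c d)
  weaken-into (Λ ∧̄ᵣ Ψ) (l , p) δ c d =
    wk∧̄ₗ {Γ = []} (seqOK (l , plug-Allˢ Ψ p δ) c) (weaken-into Ψ p δ c d)

  ⊤-right : ∀ {Γ} → Allˢ Γ → P `⊤ → L⟨ P ⟩ Γ ⇒ `⊤
  ⊤-right {fm _} a t = ax⊤ (seqOK a t)
  ⊤-right {Γ ⊙ _} (g , h) t = wk⊙ᵣ {Γ = []} (seqOK (g , h) t) (⊤-right {Γ} g t)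
  ⊤-right {Γ ∧̄ _} (g , h) t = wk∧̄ᵣ {Γ = []} (seqOK (g , h) t) (⊤-right {Γ} g t)

  cl : Pred Str 0ℓ → Pred Str 0ℓ
  cl X Γ = Allˢ Γ × (∀ {Ψ C} → Allᶜ Ψ → P C →
                     (∀ {Δ} → X Δ → L⟨ P ⟩ Ψ [ Δ ] ⇒ C) → L⟨ P ⟩ Ψ [ Γ ] ⇒ C)

  record Closed (X : Pred Str 0ℓ) : Set where
    field
      allP : X ⊆ Allˢ
      cl⊆  : cl X ⊆ X
  open Closed

  cl-mono : ∀ {X Y} → X ⊆ Y → cl X ⊆ cl Y
  cl-mono X⊆Y (g , f) = g , λ p c h → f p c (h ∘ X⊆Y)

  cl-closed : ∀ X → Closed (cl X)
  cl-closed X = record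
    { allP = proj₁
    ; cl⊆  = λ (g , f) → g , λ p c h → f p c (λ y → proj₂ y p c h)
    }

  ⊆-cl : ∀ {X} → X ⊆ Allˢ → X ⊆ cl X
  ⊆-cl X⊆ x = X⊆ x , λ _ _ h → h x

  cl-least : ∀ {X Z} → X ⊆ Z → Closed Z → cl X ⊆ Z
  cl-least X⊆Z Z-closed = cl⊆ Z-closed ∘ cl-mono X⊆Z

  cl⊆Derivable : ∀ {X C} → P C → X ⊆ Derivable C → cl X ⊆ Derivable C
  cl⊆Derivable c X⊆ (_ , f) = f {[]} tt c X⊆

  closed-under : ∀ {X S S′} → Closed X →
    (∀ {Φ C} → Allᶜ Φ → P C → L⟨ P ⟩ Φ [ S ] ⇒ C → L⟨ P ⟩ Φ [ S′ ] ⇒ C) →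
    Allˢ S′ → X S → X S′
  closed-under X-closed rule s′ x = cl⊆ X-closed (s′ , λ p c h → rule p c (h x))

  contract-∧̄ : ∀ {Z Γ} → Closed Z → Z (Γ ∧̄ Γ) → Z Γ
  contract-∧̄ {Γ = Γ} Z-closed z =
    closed-under Z-closed (λ {Φ} p c → con∧̄ {Γ = Φ} (seqOKᶜ Φ p g c)) g z
    where
    g : Allˢ Γ
    g = proj₁ (allP Z-closed z)

  ∩-closed : ∀ {X Y} → Closed X → Closed Y → Closed (X ∩ Y)
  ∩-closed X-closed Y-closed = record
    { allP = allP X-closed ∘ proj₁
    ; cl⊆  = λ z → cl⊆ X-closed (cl-mono proj₁ z) , cl⊆ Y-closed (cl-mono proj₂ z)
    }

  infixr 7 _•_

  _•_ : Pred Str 0ℓ → Pred Str 0ℓ → Pred Str 0ℓ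
  (X • Y) (Γ ⊙ Δ) = X Γ × Y Δ
  (X • Y) _ = ⊥

  •-Allˢ : ∀ {X Y} → X ⊆ Allˢ → Y ⊆ Allˢ → X • Y ⊆ Allˢ
  •-Allˢ X⊆ Y⊆ {_ ⊙ _} (x , y) = X⊆ x , Y⊆ y

  Res : (Str → Ctx) → Pred Str 0ℓ → Pred Str 0ℓ → Pred Str 0ℓ
  Res κ X Z Γ = Allˢ Γ × (∀ {Δ} → X Δ → Z (κ Δ [ Γ ]))

  Res-closed : ∀ κ {X Z} → (∀ {Δ} → Allˢ Δ → Allᶜ (κ Δ)) → X ⊆ Allˢ →
               Closed Z → Closed (Res κ X Z)
  Res-closed κ {X} {Z} κ-Allᶜ X⊆ Z-closed = record { allP = proj₁ ; cl⊆ = closure }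
    where
    -- Γ is tested against the composite context Φ ∘ᶜ κ Δ.
    closure : cl (Res κ X Z) ⊆ Res κ X Z
    closure {Γ} (g , f) = g , λ {Δ} x →
      cl⊆ Z-closed (plug-Allˢ (κ Δ) (κ-Allᶜ (X⊆ x)) g , λ {Φ} {C} p c h →
        subst (Derivable C) (plug-∘ᶜ Φ (κ Δ) Γ)
          (f (Allᶜ-∘ᶜ Φ (κ Δ) p (κ-Allᶜ (X⊆ x))) c
             (λ {Γ′} r → subst (Derivable C) (sym (plug-∘ᶜ Φ (κ Δ) Γ′)) (h (proj₂ r x)))))

  ⟦_⟧ : Fm → Pred Str 0ℓ
  -- guarded by P (var n) so that the set stays closed when var n is not allowed
  ⟦ var n ⟧ Γ = Allˢ Γ × (P (var n) → L⟨ P ⟩ Γ ⇒ var n)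
  ⟦ `⊤ ⟧ = Allˢ
  ⟦ `⊥ ⟧ = cl ∅
  ⟦ A ∧ B ⟧ = ⟦ A ⟧ ∩ ⟦ B ⟧
  ⟦ A ∨ B ⟧ = cl (⟦ A ⟧ ∪ ⟦ B ⟧)
  ⟦ A · B ⟧ = cl (⟦ A ⟧ • ⟦ B ⟧)
  ⟦ A ⊸ B ⟧ = Res (λ Δ → _⊙ᵣ_ Δ []) ⟦ A ⟧ ⟦ B ⟧
  ⟦ B ⟜ A ⟧ = Res (_⊙ₗ_ []) ⟦ A ⟧ ⟦ B ⟧

  ⟦_⟧-closed : ∀ A → Closed ⟦ A ⟧
  ⟦ var n ⟧-closed = record
    { allP = proj₁
    ; cl⊆  = λ (g , f) → g , λ p → cl⊆Derivable p (λ x → proj₂ x p) (g , f)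
    }
  ⟦ `⊤ ⟧-closed = record { allP = λ g → g ; cl⊆ = proj₁ }
  ⟦ `⊥ ⟧-closed = cl-closed _
  ⟦ A ∧ B ⟧-closed = ∩-closed ⟦ A ⟧-closed ⟦ B ⟧-closed
  ⟦ A ∨ B ⟧-closed = cl-closed _
  ⟦ A · B ⟧-closed = cl-closed _
  ⟦ A ⊸ B ⟧-closed = Res-closed (λ Δ → _⊙ᵣ_ Δ []) (_, tt) (allP ⟦ A ⟧-closed) ⟦ B ⟧-closed
  ⟦ B ⟜ A ⟧-closed = Res-closed (_⊙ₗ_ []) (tt ,_) (allP ⟦ A ⟧-closed) ⟦ B ⟧-closed

  ⟦_⟧ˢ : Str → Pred Str 0ℓ
  ⟦ fm A ⟧ˢ = ⟦ A ⟧
  ⟦ Γ ⊙ Δ ⟧ˢ = cl (⟦ Γ ⟧ˢ • ⟦ Δ ⟧ˢ)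
  ⟦ Γ ∧̄ Δ ⟧ˢ = ⟦ Γ ⟧ˢ ∩ ⟦ Δ ⟧ˢ

  ⟦_⟧ˢ-closed : ∀ Γ → Closed ⟦ Γ ⟧ˢ
  ⟦ fm A ⟧ˢ-closed = ⟦ A ⟧-closed
  ⟦ Γ ⊙ Δ ⟧ˢ-closed = cl-closed _
  ⟦ Γ ∧̄ Δ ⟧ˢ-closed = ∩-closed ⟦ Γ ⟧ˢ-closed ⟦ Δ ⟧ˢ-closed

  allPˢ : ∀ Γ → ⟦ Γ ⟧ˢ ⊆ Allˢ
  allPˢ Γ = allP ⟦ Γ ⟧ˢ-closed

  ⊙-∈⟦⟧ˢ : ∀ Γ Δ {Γ′ Δ′} → ⟦ Γ ⟧ˢ Γ′ → ⟦ Δ ⟧ˢ Δ′ → ⟦ Γ ⊙ Δ ⟧ˢ (Γ′ ⊙ Δ′)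
  ⊙-∈⟦⟧ˢ Γ Δ x y = ⊆-cl (•-Allˢ (allPˢ Γ) (allPˢ Δ)) (x , y)

  ∧̄-∈⟦⟧ˢ : ∀ Γ Δ {Γ′ Δ′} → ⟦ Γ ⟧ˢ Γ′ → ⟦ Δ ⟧ˢ Δ′ → ⟦ Γ ∧̄ Δ ⟧ˢ (Γ′ ∧̄ Δ′)
  ∧̄-∈⟦⟧ˢ Γ Δ {Γ′} {Δ′} x y =
      closed-under ⟦ Γ ⟧ˢ-closed (λ {Φ} p c → wk∧̄ᵣ {Γ = Φ} (seqOKᶜ Φ p s c)) s x
    , closed-under ⟦ Δ ⟧ˢ-closed (λ {Φ} p c → wk∧̄ₗ {Γ = Φ} (seqOKᶜ Φ p s c)) s y
    where
    s : Allˢ (Γ′ ∧̄ Δ′)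
    s = allPˢ Γ x , allPˢ Δ y

  Residual : Ctx → Pred Str 0ℓ → Pred Str 0ℓ
  Residual [] Z = Z
  Residual (Ψ ⊙ₗ Λ) Z = Residual Ψ (Res (_⊙ₗ_ []) ⟦ Λ ⟧ˢ Z)
  Residual (Λ ⊙ᵣ Ψ) Z = Residual Ψ (Res (λ Δ → _⊙ᵣ_ Δ []) ⟦ Λ ⟧ˢ Z)
  Residual (Ψ ∧̄ₗ Λ) Z = Residual Ψ (Res (_∧̄ₗ_ []) ⟦ Λ ⟧ˢ Z)
  Residual (Λ ∧̄ᵣ Ψ) Z = Residual Ψ (Res (λ Δ → _∧̄ᵣ_ Δ []) ⟦ Λ ⟧ˢ Z)

  Residual-closed : ∀ Ψ {Z} → Closed Z → Closed (Residual Ψ Z)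
  Residual-closed [] Z-closed = Z-closed
  Residual-closed (Ψ ⊙ₗ Λ) Z-closed =
    Residual-closed Ψ (Res-closed (_⊙ₗ_ []) (tt ,_) (allPˢ Λ) Z-closed)
  Residual-closed (Λ ⊙ᵣ Ψ) Z-closed =
    Residual-closed Ψ (Res-closed (λ Δ → _⊙ᵣ_ Δ []) (_, tt) (allPˢ Λ) Z-closed)
  Residual-closed (Ψ ∧̄ₗ Λ) Z-closed =
    Residual-closed Ψ (Res-closed (_∧̄ₗ_ []) (tt ,_) (allPˢ Λ) Z-closed)
  Residual-closed (Λ ∧̄ᵣ Ψ) Z-closed =
    Residual-closed Ψ (Res-closed (λ Δ → _∧̄ᵣ_ Δ []) (_, tt) (allPˢ Λ) Z-closed)

  Residual→plug : ∀ Ψ Δ {Z} → Closed Z → ⟦ Δ ⟧ˢ ⊆ Residual Ψ Z → ⟦ Ψ [ Δ ] ⟧ˢ ⊆ Z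
  Residual→plug [] Δ Z-closed s = s
  Residual→plug (Ψ ⊙ₗ Λ) Δ Z-closed s = cl-least
    (λ { {_ ⊙ _} (x , y) →
         proj₂ (Residual→plug Ψ Δ (Res-closed (_⊙ₗ_ []) (tt ,_) (allPˢ Λ) Z-closed) s x) y })
    Z-closed
  Residual→plug (Λ ⊙ᵣ Ψ) Δ Z-closed s = cl-least
    (λ { {_ ⊙ _} (y , x) →
         proj₂ (Residual→plug Ψ Δ (Res-closed (λ Δ → _⊙ᵣ_ Δ []) (_, tt) (allPˢ Λ) Z-closed) s x) y })
    Z-closed
  Residual→plug (Ψ ∧̄ₗ Λ) Δ Z-closed s (x , y) = contract-∧̄ Z-closed
    (proj₂ (Residual→plug Ψ Δ (Res-closed (_∧̄ₗ_ []) (tt ,_) (allPˢ Λ) Z-closed) s x) y)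
  Residual→plug (Λ ∧̄ᵣ Ψ) Δ Z-closed s (y , x) = contract-∧̄ Z-closed
    (proj₂ (Residual→plug Ψ Δ (Res-closed (λ Δ → _∧̄ᵣ_ Δ []) (_, tt) (allPˢ Λ) Z-closed) s x) y)

  plug→Residual : ∀ Ψ Δ {Z} → Closed Z → ⟦ Ψ [ Δ ] ⟧ˢ ⊆ Z → ⟦ Δ ⟧ˢ ⊆ Residual Ψ Z
  plug→Residual [] Δ Z-closed s = s
  plug→Residual (Ψ ⊙ₗ Λ) Δ Z-closed s =
    plug→Residual Ψ Δ (Res-closed (_⊙ₗ_ []) (tt ,_) (allPˢ Λ) Z-closed)
      λ x → allPˢ (Ψ [ Δ ]) x , λ y → s (⊙-∈⟦⟧ˢ (Ψ [ Δ ]) Λ x y)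
  plug→Residual (Λ ⊙ᵣ Ψ) Δ Z-closed s =
    plug→Residual Ψ Δ (Res-closed (λ Δ → _⊙ᵣ_ Δ []) (_, tt) (allPˢ Λ) Z-closed)
      λ x → allPˢ (Ψ [ Δ ]) x , λ y → s (⊙-∈⟦⟧ˢ Λ (Ψ [ Δ ]) y x)
  plug→Residual (Ψ ∧̄ₗ Λ) Δ Z-closed s =
    plug→Residual Ψ Δ (Res-closed (_∧̄ₗ_ []) (tt ,_) (allPˢ Λ) Z-closed)
      λ x → allPˢ (Ψ [ Δ ]) x , λ y → s (∧̄-∈⟦⟧ˢ (Ψ [ Δ ]) Λ x y)
  plug→Residual (Λ ∧̄ᵣ Ψ) Δ Z-closed s =
    plug→Residual Ψ Δ (Res-closed (λ Δ → _∧̄ᵣ_ Δ []) (_, tt) (allPˢ Λ) Z-closed)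
      λ x → allPˢ (Ψ [ Δ ]) x , λ y → s (∧̄-∈⟦⟧ˢ Λ (Ψ [ Δ ]) y x)

  plug-mono : ∀ Ψ Δ Δ′ {Z} → Closed Z → ⟦ Δ ⟧ˢ ⊆ ⟦ Δ′ ⟧ˢ →
              ⟦ Ψ [ Δ′ ] ⟧ˢ ⊆ Z → ⟦ Ψ [ Δ ] ⟧ˢ ⊆ Z
  plug-mono Ψ Δ Δ′ Z-closed Δ⊆Δ′ s =
    Residual→plug Ψ Δ Z-closed (plug→Residual Ψ Δ′ Z-closed s ∘ Δ⊆Δ′)

  soundness : ∀ {Γ A} → Γ ⊢ A → ⟦ Γ ⟧ˢ ⊆ ⟦ A ⟧
  soundness (ax _) x = x
  soundness (ax⊤ {A} _) = allP ⟦ A ⟧-closed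
  soundness (ax⊥ {A} _) = cl-least (λ ()) ⟦ A ⟧-closed
  soundness (⊸L {Ψ} {Δ} {A} {B} {C} _ d e) =
    plug-mono Ψ (Δ ⊙ fm (A ⊸ B)) (fm B) ⟦ C ⟧-closed
      (cl-least (λ { {_ ⊙ _} (x , f) → proj₂ f (soundness d x) }) ⟦ B ⟧-closed)
      (soundness e)
  soundness (⊸R {Γ} {A} _ d) x = allPˢ Γ x , λ a → soundness d (⊙-∈⟦⟧ˢ (fm A) Γ a x)
  soundness (⟜L {Ψ} {Δ} {A} {B} {C} _ d e) =
    plug-mono Ψ (fm (B ⟜ A) ⊙ Δ) (fm B) ⟦ C ⟧-closed
      (cl-least (λ { {_ ⊙ _} (f , x) → proj₂ f (soundness d x) }) ⟦ B ⟧-closed)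
      (soundness e)
  soundness (⟜R {Γ} {A} _ d) x = allPˢ Γ x , λ a → soundness d (⊙-∈⟦⟧ˢ Γ (fm A) x a)
  soundness (·L {Ψ} {A} {B} {C} _ d) =
    plug-mono Ψ (fm (A · B)) (fm A ⊙ fm B) ⟦ C ⟧-closed (λ x → x) (soundness d)
  soundness (·R _ d e) = cl-mono λ { {_ ⊙ _} (x , y) → soundness d x , soundness e y }
  soundness (∧L {Ψ} {A} {B} {C} _ d) =
    plug-mono Ψ (fm (A ∧ B)) (fm A ∧̄ fm B) ⟦ C ⟧-closed (λ x → x) (soundness d)
  soundness (∧R _ d e) (x , y) = soundness d x , soundness e y
  soundness (∨L {Ψ} {A} {B} {C} _ d e) =
    Residual→plug Ψ (fm (A ∨ B)) ⟦ C ⟧-closed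
      (cl-least [ plug→Residual Ψ (fm A) ⟦ C ⟧-closed (soundness d)
                , plug→Residual Ψ (fm B) ⟦ C ⟧-closed (soundness e) ]′
                (Residual-closed Ψ ⟦ C ⟧-closed))
  soundness (∨R₁ {A = A} {B} _ d) =
    ⊆-cl [ allP ⟦ A ⟧-closed , allP ⟦ B ⟧-closed ]′ ∘ inj₁ ∘ soundness d
  soundness (∨R₂ {A = A} {B} _ d) =
    ⊆-cl [ allP ⟦ A ⟧-closed , allP ⟦ B ⟧-closed ]′ ∘ inj₂ ∘ soundness d
  soundness (con∧̄ {Ψ} {Δ} {C} _ d) =
    plug-mono Ψ Δ (Δ ∧̄ Δ) ⟦ C ⟧-closed (λ x → x , x) (soundness d)
  soundness (exch∧̄ {Ψ} {Δ} {Λ} {C} _ d) =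
    plug-mono Ψ (Λ ∧̄ Δ) (Δ ∧̄ Λ) ⟦ C ⟧-closed (λ (x , y) → y , x) (soundness d)
  soundness (assoc∧̄₁ {Ψ} {Δ₁} {Δ₂} {Δ₃} {C} _ d) =
    plug-mono Ψ (Δ₁ ∧̄ (Δ₂ ∧̄ Δ₃)) ((Δ₁ ∧̄ Δ₂) ∧̄ Δ₃) ⟦ C ⟧-closed
      (λ (x , (y , z)) → (x , y) , z) (soundness d)
  soundness (assoc∧̄₂ {Ψ} {Δ₁} {Δ₂} {Δ₃} {C} _ d) =
    plug-mono Ψ ((Δ₁ ∧̄ Δ₂) ∧̄ Δ₃) (Δ₁ ∧̄ (Δ₂ ∧̄ Δ₃)) ⟦ C ⟧-closed
      (λ ((x , y) , z) → x , (y , z)) (soundness d)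
  soundness (con⊙ {Ψ} {Λ} {Δ} {C} _ d) =
    plug-mono Ψ (Λ ⊙ Δ) ((Λ ⊙ Δ) ⊙ Δ) ⟦ C ⟧-closed
      (cl-least contract ⟦ (Λ ⊙ Δ) ⊙ Δ ⟧ˢ-closed) (soundness d)
    where
    contract : ⟦ Λ ⟧ˢ • ⟦ Δ ⟧ˢ ⊆ ⟦ (Λ ⊙ Δ) ⊙ Δ ⟧ˢ
    contract {_ ⊙ _} (x , y) =
      closed-under ⟦ (Λ ⊙ Δ) ⊙ Δ ⟧ˢ-closed
        (λ {Φ} p c → con⊙ {Γ = Φ} (seqOKᶜ Φ p (allPˢ Λ x , allPˢ Δ y) c))
        (allPˢ Λ x , allPˢ Δ y)
        (⊙-∈⟦⟧ˢ (Λ ⊙ Δ) Δ (⊙-∈⟦⟧ˢ Λ Δ x y) y)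
  soundness (wk⊙ₗ {Ψ} {Δ} {Λ} {C} _ d) =
    plug-mono Ψ (Λ ⊙ Δ) Δ ⟦ C ⟧-closed (cl-least weaken ⟦ Δ ⟧ˢ-closed) (soundness d)
    where
    weaken : ⟦ Λ ⟧ˢ • ⟦ Δ ⟧ˢ ⊆ ⟦ Δ ⟧ˢ
    weaken {_ ⊙ _} (x , y) = closed-under ⟦ Δ ⟧ˢ-closed
      (λ {Φ} p c → wk⊙ₗ {Γ = Φ} (seqOKᶜ Φ p (allPˢ Λ x , allPˢ Δ y) c))
      (allPˢ Λ x , allPˢ Δ y) y
  soundness (wk⊙ᵣ {Ψ} {Δ} {Λ} {C} _ d) =
    plug-mono Ψ (Δ ⊙ Λ) Δ ⟦ C ⟧-closed (cl-least weaken ⟦ Δ ⟧ˢ-closed) (soundness d)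
    where
    weaken : ⟦ Δ ⟧ˢ • ⟦ Λ ⟧ˢ ⊆ ⟦ Δ ⟧ˢ
    weaken {_ ⊙ _} (y , x) = closed-under ⟦ Δ ⟧ˢ-closed
      (λ {Φ} p c → wk⊙ᵣ {Γ = Φ} (seqOKᶜ Φ p (allPˢ Δ y , allPˢ Λ x) c))
      (allPˢ Δ y , allPˢ Λ x) y
  soundness (wk∧̄ₗ {Ψ} {Δ} {Λ} {C} _ d) =
    plug-mono Ψ (Λ ∧̄ Δ) Δ ⟦ C ⟧-closed proj₂ (soundness d)
  soundness (wk∧̄ᵣ {Ψ} {Δ} {Λ} {C} _ d) =
    plug-mono Ψ (Δ ∧̄ Λ) Δ ⟦ C ⟧-closed proj₁ (soundness d)
  soundness (cut {Ψ} {Δ} {A} {C} _ d e) =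
    plug-mono Ψ Δ (fm A) ⟦ C ⟧-closed (soundness d) (soundness e)

  fm∈⟦_⟧ : ∀ A → AllSub A → ⟦ A ⟧ (fm A)
  ⟦_⟧⊆Derivable : ∀ A → AllSub A → ⟦ A ⟧ ⊆ Derivable A

  fm∈⟦ var n ⟧ H = H ⊑-refl , λ p → ax (seqOK p p)
  fm∈⟦ `⊤ ⟧ H = H ⊑-refl
  fm∈⟦ `⊥ ⟧ H = H ⊑-refl , λ {Ψ} p c _ →
    weaken-into Ψ p (H ⊑-refl) c (ax⊥ (seqOK (H ⊑-refl) c))
  fm∈⟦ A ∧ B ⟧ H =
      closed-under ⟦ A ⟧-closed
        (λ {Φ} p c → ∧L {Γ = Φ} (seqOKᶜ Φ p (H ⊑-refl) c)
                   ∘ wk∧̄ᵣ {Γ = Φ} (seqOKᶜ Φ p (H (⊑∧ₗ ⊑-refl) , H (⊑∧ᵣ ⊑-refl)) c))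
        (H ⊑-refl) (fm∈⟦ A ⟧ (H ∘ ⊑∧ₗ))
    , closed-under ⟦ B ⟧-closed
        (λ {Φ} p c → ∧L {Γ = Φ} (seqOKᶜ Φ p (H ⊑-refl) c)
                   ∘ wk∧̄ₗ {Γ = Φ} (seqOKᶜ Φ p (H (⊑∧ₗ ⊑-refl) , H (⊑∧ᵣ ⊑-refl)) c))
        (H ⊑-refl) (fm∈⟦ B ⟧ (H ∘ ⊑∧ᵣ))
  fm∈⟦ A ∨ B ⟧ H = H ⊑-refl , λ {Ψ} p c h →
    ∨L {Γ = Ψ} (seqOKᶜ Ψ p (H ⊑-refl) c)
      (h (inj₁ (fm∈⟦ A ⟧ (H ∘ ⊑∨ₗ)))) (h (inj₂ (fm∈⟦ B ⟧ (H ∘ ⊑∨ᵣ))))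
  fm∈⟦ A · B ⟧ H = H ⊑-refl , λ {Ψ} p c h →
    ·L {Γ = Ψ} (seqOKᶜ Ψ p (H ⊑-refl) c) (h (fm∈⟦ A ⟧ (H ∘ ⊑·ₗ) , fm∈⟦ B ⟧ (H ∘ ⊑·ᵣ)))
  fm∈⟦ A ⊸ B ⟧ H = H ⊑-refl , λ x →
    let s = allP ⟦ A ⟧-closed x , H ⊑-refl in
    closed-under ⟦ B ⟧-closed
      (λ {Φ} p c → ⊸L {Γ = Φ} (seqOKᶜ Φ p s c) (⟦ A ⟧⊆Derivable (H ∘ ⊑⊸ₗ) x))
      s (fm∈⟦ B ⟧ (H ∘ ⊑⊸ᵣ))
  fm∈⟦ B ⟜ A ⟧ H = H ⊑-refl , λ x →
    let s = H ⊑-refl , allP ⟦ A ⟧-closed x in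
    closed-under ⟦ B ⟧-closed
      (λ {Φ} p c → ⟜L {Γ = Φ} (seqOKᶜ Φ p s c) (⟦ A ⟧⊆Derivable (H ∘ ⊑⟜ᵣ) x))
      s (fm∈⟦ B ⟧ (H ∘ ⊑⟜ₗ))

  ⟦ var n ⟧⊆Derivable H (_ , f) = f (H ⊑-refl)
  ⟦ `⊤ ⟧⊆Derivable H g = ⊤-right g (H ⊑-refl)
  ⟦ `⊥ ⟧⊆Derivable H = cl⊆Derivable (H ⊑-refl) (λ ())
  ⟦ A ∧ B ⟧⊆Derivable H (x , y) =
    let a = allP ⟦ A ⟧-closed x in
    con∧̄ {Γ = []} (seqOK a (H ⊑-refl))
      (∧R (seqOK (a , a) (H ⊑-refl))
        (⟦ A ⟧⊆Derivable (H ∘ ⊑∧ₗ) x) (⟦ B ⟧⊆Derivable (H ∘ ⊑∧ᵣ) y))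
  ⟦ A ∨ B ⟧⊆Derivable H = cl⊆Derivable (H ⊑-refl)
    [ (λ x → ∨R₁ (seqOK (allP ⟦ A ⟧-closed x) (H ⊑-refl)) (⟦ A ⟧⊆Derivable (H ∘ ⊑∨ₗ) x))
    , (λ y → ∨R₂ (seqOK (allP ⟦ B ⟧-closed y) (H ⊑-refl)) (⟦ B ⟧⊆Derivable (H ∘ ⊑∨ᵣ) y)) ]′
  ⟦ A · B ⟧⊆Derivable H = cl⊆Derivable (H ⊑-refl) λ { {_ ⊙ _} (x , y) →
    ·R (seqOK (allP ⟦ A ⟧-closed x , allP ⟦ B ⟧-closed y) (H ⊑-refl))
       (⟦ A ⟧⊆Derivable (H ∘ ⊑·ₗ) x) (⟦ B ⟧⊆Derivable (H ∘ ⊑·ᵣ) y) }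
  ⟦ A ⊸ B ⟧⊆Derivable H (g , f) =
    ⊸R (seqOK g (H ⊑-refl)) (⟦ B ⟧⊆Derivable (H ∘ ⊑⊸ᵣ) (f (fm∈⟦ A ⟧ (H ∘ ⊑⊸ₗ))))
  ⟦ B ⟜ A ⟧⊆Derivable H (g , f) =
    ⟜R (seqOK g (H ⊑-refl)) (⟦ B ⟧⊆Derivable (H ∘ ⊑⟜ₗ) (f (fm∈⟦ A ⟧ (H ∘ ⊑⟜ᵣ))))

  self∈⟦_⟧ˢ : ∀ Γ → (∀ {B} → B ∈ˢ Γ → AllSub B) → ⟦ Γ ⟧ˢ Γ
  self∈⟦ fm A ⟧ˢ H = fm∈⟦ A ⟧ (H here)
  self∈⟦ Γ ⊙ Δ ⟧ˢ H = ⊙-∈⟦⟧ˢ Γ Δ (self∈⟦ Γ ⟧ˢ (H ∘ ⊙ₗ)) (self∈⟦ Δ ⟧ˢ (H ∘ ⊙ᵣ))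
  self∈⟦ Γ ∧̄ Δ ⟧ˢ H = ∧̄-∈⟦⟧ˢ Γ Δ (self∈⟦ Γ ⟧ˢ (H ∘ ∧̄ₗ)) (self∈⟦ Δ ⟧ˢ (H ∘ ∧̄ᵣ))

corollary3 : ∀ {Γ A} → Γ ⊢ A → L⟨ SubOf Γ A ⟩ Γ ⇒ A
corollary3 {Γ} {A} d =
  ⟦ A ⟧⊆Derivable (inj₂ ∘ inj₂ ∘ inj₂) (soundness d (self∈⟦ Γ ⟧ˢ in-Γ))
  where
  open Frame (SubOf Γ A)

  in-Γ : ∀ {B} → B ∈ˢ Γ → AllSub B
  in-Γ {B} m s = inj₂ (inj₂ (inj₁ (B , m , s)))
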